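{- Let $n\ge1$, $\sigma\in S_n$, and let $\lambda$ be a partition with at most $n$ parts, regarded as a weak composition with $n$ parts by appending zeros. Then \[ \mathrm{E}^\sigma_\lambda(x_1,\dots,x_n;1,0)=e_{\lambda'}(x_1,\dots,x_n), \] where $\lambda'$ is the conjugate partition and $e_\nu=\prod_i e_{\nu_i}$.
   Context: Permuted-basement Macdonald polynomials. For a weak composition $\lambda=(\lambda_1,\dots,\lambda_n)$ and $\sigma\in S_n$ in one-line notation, an augmented filling of shape $\lambda$ and basement $\sigma$ assigns a positive integer to each box $(r,c)$, $1\le r\le n$, $0\le c\le\lambda_r$ (rows from the top), with $F(r,0)=\sigma_r$; column $0$ is the basement, boxes with $c\ge1$ are non-basement. Two boxes are attacking if they have equal entries and either lie in the same column or in adjacent columns $c-1,c$ with the box in column $c$ strictly below the other. $\mathrm{NAF}_\sigma(\lambda)$: fillings with no attacking pair and non-basement entries in $\{1,\dots,n\}$. Type $A$ triple: $a=(r,c-1)$, $b=(r,c)$, $z=(r',c)$ with $c\ge1$, $r'>r$, $\lambda_r\ge\lambda_{r'}$. Type $B$ triple: $a=(r,c-1)$, $b=(r,c)$, $z=(r',c-1)$ with $c\ge1$, $r'<r$, $\lambda_r>\lambda_{r'}$. With $A=F(a),B=F(b),C=F(z)$, comparing $(A,3),(C,2),(B,1)$ lexicographically, the triple is an inversion triple if $A<C<B$, $C<B<A$ or $B<A<C$, otherwise a coinversion triple; $\mathrm{coinv}(F)$ counts coinversion triples. For $u=(r,c)$: $\mathrm{leg}(u)=\lambda_r-c$, $\mathrm{arm}(u)=\#\{r'>r:\lambda_{r'}\le\lambda_r,\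 c\le\lambda_{r'}\}+\#\{r'<r:\lambda_{r'}<\lambda_r,\ c-1\le\lambda_{r'}\}$. A descent is a non-basement box $u=(r,c)$ with $F(r,c-1)<F(r,c)$; $\mathrm{maj}(F)=\sum_{u\text{ descent}}(\mathrm{leg}(u)+1)$; $\mathbf{x}^F=\prod_{u\text{ non-basement}}x_{F(u)}$. \[\mathrm{E}^\sigma_\lambda(\mathbf{x};q,t)=\sum_{F\in\mathrm{NAF}_\sigma(\lambda)}\mathbf{x}^F q^{\mathrm{maj}(F)}t^{\mathrm{coinv}(F)}\prod_{\substack{u=(r,c),\,c\ge1\\ F(r,c-1)\ne F(r,c)}}\frac{1-t}{1-q^{1+\mathrm{leg}(u)}t^{1+\mathrm{arm}(u)}}.\] (At $t=0$ (with $0^0=1$) only coinversion-free fillings contribute, each with coefficient $q^{\mathrm{maj}(F)}$.) -}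

module Defs where

open import Data.Nat using (ℕ; zero; suc; _+_; _*_; _∸_; _^_; _≤_; _<_; _⊔_; _≡ᵇ_; _<ᵇ_; _≤ᵇ_; _≤?_)
open import Data.Bool using (Bool; true; false; _∧_; _∨_; not; if_then_else_)
open import Data.Nat.ListAction using (sum; product)
open import Data.List using (List; []; _∷_; [_]; map; concatMap; upTo; length; filter; foldr; _++_; replicate; allFin)
open import Data.Product using (_×_; _,_)
open import Data.Vec using (Vec; toList)
open import Data.Fin using (Fin; toℕ)
open import Data.Fin.Permutation using (Permutation′; _⟨$⟩ʳ_)

-- Conventions: rows r and columns c are 0-based naturals internally:
-- row index r ∈ {0..n-1} stands for row r+1 (rows counted from the top);
-- column 0 is the basement, columns 1..λ_r are the non-basement boxes.
-- Entries (basement and non-basement) are naturals in {1..n}.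

lookupD : {A : Set} → A → List A → ℕ → A
lookupD d [] _ = d
lookupD d (a ∷ as) zero = a
lookupD d (a ∷ as) (suc i) = lookupD d as i

-- Fillings.  A filling of shape ls (a weak composition, as a list of
-- length n) is given by its rows: row r is the list of its entries in
-- columns 1..ls_r.  The basement is a separate list.

words : ℕ → ℕ → List (List ℕ)
words n zero = [] ∷ []
words n (suc k) = concatMap (λ a → map (a ∷_) (words n k)) (map suc (upTo n))

fillings : ℕ → List ℕ → List (List (List ℕ))
fillings n [] = [] ∷ []
fillings n (l ∷ ls) = concatMap (λ w → map (w ∷_) (fillings n ls)) (words n l)

Cell : Set
Cell = ℕ × ℕ

module Filling (n : ℕ) (shape : List ℕ) (basement : List ℕ) (rows : List (List ℕ)) where

  shp : ℕ → ℕ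
  shp r = lookupD 0 shape r

  F : ℕ → ℕ → ℕ
  F r zero = lookupD 0 basement r
  F r (suc c) = lookupD 0 (lookupD [] rows r) c

  cells : List Cell
  cells = concatMap (λ r → map (λ c → (r , c)) (upTo (suc (shp r)))) (upTo n)

  boxes : List Cell
  boxes = concatMap (λ r → map (λ c → (r , suc c)) (upTo (shp r))) (upTo n)

  sameCell : Cell → Cell → Bool
  sameCell (r , c) (r' , c') = (r ≡ᵇ r') ∧ (c ≡ᵇ c')

  attacks : Cell → Cell → Bool
  attacks (r , c) (r' , c') =
    (F r c ≡ᵇ F r' c') ∧
    ((c ≡ᵇ c') ∨ ((c' ≡ᵇ suc c) ∧ (r <ᵇ r')) ∨ ((c ≡ᵇ suc c') ∧ (r' <ᵇ r)))

  nonAttacking : Bool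
  nonAttacking =
    foldr _∧_ true
      (concatMap (λ u → map (λ v → sameCell u v ∨ not (attacks u v)) cells) cells)

  -- lexicographic comparison of (A,3),(C,2),(B,1)
  ltK : ℕ × ℕ → ℕ × ℕ → Bool
  ltK (x , i) (y , j) = (x <ᵇ y) ∨ ((x ≡ᵇ y) ∧ (i <ᵇ j))

  isInversion : ℕ → ℕ → ℕ → Bool
  isInversion A B C =
    let a = (A , 3) ; b = (B , 1) ; z = (C , 2) in
    (ltK a z ∧ ltK z b) ∨ (ltK z b ∧ ltK b a) ∨ (ltK b a ∧ ltK a z)

  -- number of coinversion triples with a=(r,c-1), b=(r,c) and third row r'
  coinvAt : ℕ → ℕ → ℕ → ℕ
  coinvAt r c r' =
    (if (r <ᵇ r') ∧ (shp r' ≤ᵇ shp r) ∧ (c ≤ᵇ shp r')        -- type A, z = (r',c)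
       then (if isInversion (F r (c ∸ 1)) (F r c) (F r' c) then 0 else 1)
       else 0)
    +
    (if (r' <ᵇ r) ∧ (shp r' <ᵇ shp r) ∧ ((c ∸ 1) ≤ᵇ shp r') -- type B, z = (r',c-1)
       then (if isInversion (F r (c ∸ 1)) (F r c) (F r' (c ∸ 1)) then 0 else 1)
       else 0)

  coinv : ℕ
  coinv = sum (map (λ { (r , c) → sum (map (coinvAt r c) (upTo n)) }) boxes)

  leg : Cell → ℕ
  leg (r , c) = shp r ∸ c

  maj : ℕ
  maj = sum (map (λ { (r , c) → if F r (c ∸ 1) <ᵇ F r c then suc (leg (r , c)) else 0 }) boxes)

  monomial : List ℕ → ℕ
  monomial xs = product (map (λ { (r , c) → lookupD 0 xs (F r c ∸ 1) }) boxes)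

-- E^σ_λ(x; q, 0): at t = 0 every factor (1-t)/(1-q^{1+leg} t^{1+arm})
-- equals 1 (as 1+arm ≥ 1), and t^{coinv} = 0^{coinv} (with 0^0 = 1).

E-at-t0 : (n : ℕ) → Permutation′ n → List ℕ → ℕ → Vec ℕ n → ℕ
E-at-t0 n σ shape q x =
  sum (map weight (filter (λ rows → Data.Bool._≟_ (Filling.nonAttacking n shape bas rows) true) (fillings n shape)))
  where
  bas : List ℕ
  bas = map (λ i → suc (toℕ (σ ⟨$⟩ʳ i))) (allFin n)
  weight : List (List ℕ) → ℕ
  weight rows = let open Filling n shape bas rows in
    monomial (toList x) * q ^ maj * 0 ^ coinv

data Decreasing : List ℕ → Set where
  []  : Decreasing []
  [-] : ∀ {a} → Decreasing (a ∷ [])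
  _∷_ : ∀ {a b l} → b ≤ a → Decreasing (b ∷ l) → Decreasing (a ∷ b ∷ l)

data AllPositive : List ℕ → Set where
  []  : AllPositive []
  _∷_ : ∀ {a l} → 0 < a → AllPositive l → AllPositive (a ∷ l)

IsPartition : List ℕ → Set
IsPartition λ' = Decreasing λ' × AllPositive λ'

pad : ℕ → List ℕ → List ℕ
pad n l = l ++ replicate (n ∸ length l) 0

conjugate : List ℕ → List ℕ
conjugate l = map (λ j → length (filter (λ p → suc j ≤? p) l)) (upTo (foldr _⊔_ 0 l))

sublists : List ℕ → List (List ℕ)
sublists [] = [] ∷ []
sublists (a ∷ as) = sublists as ++ map (a ∷_) (sublists as)

elem : ℕ → List ℕ → ℕ
elem k xs = sum (map product (filter (λ s → length s Data.Nat.≟ k) (sublists xs)))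

elemProd : List ℕ → List ℕ → ℕ
elemProd ν xs = product (map (λ k → elem k xs) ν)

-- At t = 0 only coinversion-free fillings survive, each contributing x^F when q = 1. A partition
-- shape has no type B triples, and a type A triple a = (r, c-1), b = (r, c), z = (r', c) is an
-- inversion iff F z comes before F b in the order F a + 1 < ⋯ < n < 1 < ⋯ < F a. Since the
-- basement is a permutation, coinversion-free fillings are automatically non-attacking. Build
-- them column by column: whatever the column on its left, a column of height h is a letter u on
-- top of a column of height h - 1 of the same kind whose letters all precede u in the order cut
-- at u's left neighbour. Grouping the h-subsets of {1, …, n} by their largest element in that
-- order gives Σ_u x_u e_{h-1}(letters preceding u) = e_h, so by induction every column of
-- height h contributes e_h, whatever lies to its left, and the sum is e_{λ'}.

module Submission where

open import Defs

open import Data.Bool using (Bool; true; false; _∧_; _∨_; not; T; if_then_else_)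
import Data.Bool as Bool
open import Data.Bool.ListAction using (all)
open import Data.Bool.Properties using (T-∧; T-∨; T-≡)
open import Data.Empty using (⊥; ⊥-elim)
open import Data.Fin as Fin using (Fin; toℕ; fromℕ<)
open import Data.Fin.Properties using (toℕ-injective; toℕ-fromℕ<)
open import Data.Fin.Permutation using (Permutation′; _⟨$⟩ʳ_; _⟨$⟩ˡ_; inverseˡ)
open import Data.List
  using (List; []; _∷_; [_]; _++_; map; concatMap; filter; foldr; drop; length; replicate; upTo; applyUpTo; tabulate; allFin)
open import Data.List.Properties
  using ( map-++; map-cong; map-cong-local; map-∘; map-applyUpTo; map-tabulate; filter-all; filter-reject
        ; length-filter; length-map; length-++; length-replicate)
open import Data.List.Relation.Binary.Permutation.Propositional
  using (_↭_; prep; swap; ↭-sym) renaming (refl to ↭-refl; trans to ↭-trans)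
open import Data.List.Relation.Binary.Permutation.Propositional.Properties
  using (All-resp-↭; ↭-length; filter-↭) renaming (map⁺ to map⁺-↭)
open import Data.List.Relation.Binary.Pointwise using (Pointwise; []; _∷_; Pointwise-length)
open import Data.List.Relation.Unary.All as All using (All; []; _∷_)
import Data.List.Relation.Unary.All.Properties as All
open import Data.List.Relation.Unary.AllPairs using ([]; _∷_)
open import Data.List.Relation.Unary.Unique.Propositional using (Unique)
import Data.List.Relation.Unary.Unique.Propositional.Properties as Unique
open import Data.Nat
open import Data.Nat.ListAction using (sum; product)
open import Data.Nat.ListAction.Properties using (sum-++; sum-↭; product-++)
open import Data.Nat.Properties
open import Data.Nat.Solver using (module +-*-Solver)
open import Data.Product using (_×_; _,_; ∃₂; proj₁; proj₂)
open import Data.Product.Function.NonDependent.Propositional using (_×-⇔_)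
open import Data.Sum using (_⊎_; inj₁; inj₂; [_,_]′)
open import Data.Vec using (Vec; toList)
open import Data.Vec.Properties using (length-toList)
open import Function using (_∘_; id)
open import Function.Bundles using (_⇔_; mk⇔; Equivalence)
open import Function.Construct.Composition using (_⇔-∘_)
open import Relation.Binary.Definitions using (tri<; tri≈; tri>)
open import Relation.Binary.PropositionalEquality hiding ([_])
open import Relation.Nullary using (¬_; Dec; yes; no; does)
open import Relation.Nullary.Decidable using (map′; T?)

open +-*-Solver using (solve; _:+_; _:*_; _:=_; con)

∑ : {A : Set} → List A → (A → ℕ) → ℕ
∑ L f = sum (map f L)

∏ : {A : Set} → List A → (A → ℕ) → ℕ
∏ L f = product (map f L)

𝟙 : Bool → ℕ
𝟙 true = 1
𝟙 false = 0

𝟙-∧ : ∀ b c → 𝟙 (b ∧ c) ≡ 𝟙 b * 𝟙 c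
𝟙-∧ true c = sym (*-identityˡ (𝟙 c))
𝟙-∧ false c = refl

module _ {A : Set} where

  ∑-++ : (L M : List A) (f : A → ℕ) → ∑ (L ++ M) f ≡ ∑ L f + ∑ M f
  ∑-++ L M f = trans (cong sum (map-++ f L M)) (sum-++ (map f L) (map f M))

  ∑-cong : (L : List A) {f g : A → ℕ} → (∀ a → f a ≡ g a) → ∑ L f ≡ ∑ L g
  ∑-cong L f≗g = cong sum (map-cong f≗g L)

  ∑-cong-local : {L : List A} {f g : A → ℕ} → All (λ a → f a ≡ g a) L → ∑ L f ≡ ∑ L g
  ∑-cong-local eqs = cong sum (map-cong-local eqs)

  ∑-zero : (L : List A) → ∑ L (λ _ → 0) ≡ 0
  ∑-zero [] = refl
  ∑-zero (a ∷ L) = ∑-zero L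

  ∑-+ : (L : List A) (f g : A → ℕ) → ∑ L (λ a → f a + g a) ≡ ∑ L f + ∑ L g
  ∑-+ [] f g = refl
  ∑-+ (a ∷ L) f g = begin
    f a + g a + ∑ L (λ a → f a + g a) ≡⟨ cong (f a + g a +_) (∑-+ L f g) ⟩
    f a + g a + (∑ L f + ∑ L g)
      ≡⟨ solve 4 (λ x y u v → x :+ y :+ (u :+ v) := x :+ u :+ (y :+ v)) refl (f a) (g a) (∑ L f) (∑ L g) ⟩
    f a + ∑ L f + (g a + ∑ L g)       ∎
    where open ≡-Reasoning

  ∑-*ˡ : (L : List A) (c : ℕ) (f : A → ℕ) → ∑ L (λ a → c * f a) ≡ c * ∑ L f
  ∑-*ˡ [] c f = sym (*-zeroʳ c)
  ∑-*ˡ (a ∷ L) c f = trans (cong (c * f a +_) (∑-*ˡ L c f)) (sym (*-distribˡ-+ c (f a) _))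

  ∑-*ʳ : (L : List A) (f : A → ℕ) (c : ℕ) → ∑ L (λ a → f a * c) ≡ ∑ L f * c
  ∑-*ʳ L f c = trans (∑-cong L (λ a → *-comm (f a) c)) (trans (∑-*ˡ L c f) (*-comm c _))

  ∑-filter : {P : A → Set} (P? : ∀ a → Dec (P a)) (L : List A) (f : A → ℕ) →
             ∑ (filter P? L) f ≡ ∑ L (λ a → 𝟙 (does (P? a)) * f a)
  ∑-filter P? [] f = refl
  ∑-filter P? (a ∷ L) f with does (P? a)
  ... | true  = cong₂ _+_ (sym (+-identityʳ (f a))) (∑-filter P? L f)
  ... | false = ∑-filter P? L f

module _ {A B : Set} where

  ∑-map : (g : A → B) (L : List A) (f : B → ℕ) → ∑ (map g L) f ≡ ∑ L (f ∘ g)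
  ∑-map g L f = cong sum (sym (map-∘ L))

  ∑-concatMap : (g : A → List B) (L : List A) (f : B → ℕ) → ∑ (concatMap g L) f ≡ ∑ L (λ a → ∑ (g a) f)
  ∑-concatMap g [] f = refl
  ∑-concatMap g (a ∷ L) f = trans (∑-++ (g a) (concatMap g L) f) (cong (∑ (g a) f +_) (∑-concatMap g L f))

  ∑-comm : (L : List A) (M : List B) (f : A → B → ℕ) → ∑ L (λ a → ∑ M (f a)) ≡ ∑ M (λ b → ∑ L (λ a → f a b))
  ∑-comm [] M f = sym (∑-zero M)
  ∑-comm (a ∷ L) M f = trans (cong (∑ M (f a) +_) (∑-comm L M f)) (sym (∑-+ M (f a) _))

∑≡0⇔ : ∀ {A : Set} (L : List A) (f : A → ℕ) → ∑ L f ≡ 0 ⇔ All (λ a → f a ≡ 0) L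
∑≡0⇔ L f = mk⇔ (to L) from
  where
  to : ∀ L → ∑ L f ≡ 0 → All (λ a → f a ≡ 0) L
  to []      _ = []
  to (a ∷ L) e = m+n≡0⇒m≡0 (f a) e ∷ to L (m+n≡0⇒n≡0 (f a) e)
  from : ∀ {L} → All (λ a → f a ≡ 0) L → ∑ L f ≡ 0
  from []       = refl
  from (e ∷ es) = cong₂ _+_ e (from es)

∑-upTo≡0⇔ : ∀ n (f : ℕ → ℕ) → ∑ (upTo n) f ≡ 0 ⇔ (∀ {i} → i < n → f i ≡ 0)
∑-upTo≡0⇔ n f = mk⇔ to from
  where
  to : ∑ (upTo n) f ≡ 0 → ∀ {i} → i < n → f i ≡ 0
  to e = All.applyUpTo⁻ (λ i → i) n (Equivalence.to (∑≡0⇔ (upTo n) f) e)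
  from : (∀ {i} → i < n → f i ≡ 0) → ∑ (upTo n) f ≡ 0
  from z = Equivalence.from (∑≡0⇔ (upTo n) f) (All.applyUpTo⁺₁ (λ i → i) n z)

module _ {A : Set} where

  ∏-++ : (L M : List A) (f : A → ℕ) → ∏ (L ++ M) f ≡ ∏ L f * ∏ M f
  ∏-++ L M f = trans (cong product (map-++ f L M)) (product-++ (map f L) (map f M))

  ∏-cong : (L : List A) {f g : A → ℕ} → (∀ a → f a ≡ g a) → ∏ L f ≡ ∏ L g
  ∏-cong L f≗g = cong product (map-cong f≗g L)

  map-lookupD-upTo : (d : A) (w : List A) → map (lookupD d w) (upTo (length w)) ≡ w
  map-lookupD-upTo d []      = refl
  map-lookupD-upTo d (a ∷ w) = cong (a ∷_) (begin
    map (lookupD d (a ∷ w)) (applyUpTo suc (length w)) ≡⟨ map-applyUpTo suc (lookupD d (a ∷ w)) (length w) ⟩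
    applyUpTo (lookupD d w) (length w)                ≡⟨ map-applyUpTo (λ i → i) (lookupD d w) (length w) ⟨
    map (lookupD d w) (upTo (length w))               ≡⟨ map-lookupD-upTo d w ⟩
    w                                                 ∎)
    where open ≡-Reasoning

  ∏-lookupD : (d : A) (w : List A) (f : A → ℕ) → ∏ (upTo (length w)) (λ i → f (lookupD d w i)) ≡ ∏ w f
  ∏-lookupD d w f = trans (cong product (map-∘ (upTo (length w)))) (cong (λ v → ∏ v f) (map-lookupD-upTo d w))

module _ {A B : Set} where

  ∏-map : (g : A → B) (L : List A) (f : B → ℕ) → ∏ (map g L) f ≡ ∏ L (f ∘ g)
  ∏-map g L f = cong product (sym (map-∘ L))

  ∏-concatMap : (g : A → List B) (L : List A) (f : B → ℕ) → ∏ (concatMap g L) f ≡ ∏ L (λ a → ∏ (g a) f)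
  ∏-concatMap g []      f = refl
  ∏-concatMap g (a ∷ L) f = trans (∏-++ (g a) (concatMap g L) f) (cong (∏ (g a) f *_) (∏-concatMap g L f))

lookupD-drop-1 : ∀ {A : Set} (d : A) xs i → lookupD d (drop 1 xs) i ≡ lookupD d xs (suc i)
lookupD-drop-1 d []       i = refl
lookupD-drop-1 d (x ∷ xs) i = refl

module _ {A : Set} {P : A → Set} (d : A) where

  All-lookupD : ∀ {xs} → All P xs → ∀ {i} → i < length xs → P (lookupD d xs i)
  All-lookupD (px ∷ _)   {zero}  _         = px
  All-lookupD (_  ∷ pxs) {suc i} (s≤s i<n) = All-lookupD pxs i<n

  All-lookupD⁻ : ∀ xs → (∀ {i} → i < length xs → P (lookupD d xs i)) → All P xs
  All-lookupD⁻ []       _ = []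
  All-lookupD⁻ (x ∷ xs) f = f z<s ∷ All-lookupD⁻ xs (λ i<n → f (s<s i<n))

lookupD-tabulate : ∀ {A : Set} (d : A) {n} (f : Fin n → A) {r} (r<n : r < n) → lookupD d (tabulate f) r ≡ f (fromℕ< r<n)
lookupD-tabulate d {suc n} f {zero}  _         = refl
lookupD-tabulate d {suc n} f {suc r} (s≤s r<n) = lookupD-tabulate d (f ∘ Fin.suc) r<n

-- Elementary symmetric polynomials

esym : ℕ → List ℕ → ℕ
esym zero    _        = 1
esym (suc k) []       = 0
esym (suc k) (a ∷ as) = esym (suc k) as + a * esym k as

elem≡esym : ∀ k xs → elem k xs ≡ esym k xs
elem≡esym k xs = trans (∑-filter (λ s → length s ≟ k) (sublists xs) product) (∑-sublists k xs)
  where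
  ∑-sublists : ∀ k xs → ∑ (sublists xs) (λ s → 𝟙 (does (length s ≟ k)) * product s) ≡ esym k xs
  ∑-sublists zero    []       = refl
  ∑-sublists (suc k) []       = refl
  ∑-sublists zero    (a ∷ as) =
    trans (∑-++ (sublists as) _ _)
          (cong₂ _+_ (∑-sublists 0 as) (trans (∑-map (a ∷_) (sublists as) _) (∑-zero (sublists as))))
  ∑-sublists (suc k) (a ∷ as) =
    trans (∑-++ (sublists as) _ _) (cong₂ _+_ (∑-sublists (suc k) as) (begin
      ∑ (map (a ∷_) (sublists as)) (λ s → 𝟙 (does (length s ≟ suc k)) * product s)
        ≡⟨ ∑-map (a ∷_) (sublists as) _ ⟩
      ∑ (sublists as) (λ s → 𝟙 (does (length s ≟ k)) * (a * product s))
        ≡⟨ ∑-cong (sublists as) (λ s →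
             solve 3 (λ i x p → i :* (x :* p) := x :* (i :* p)) refl (𝟙 (does (length s ≟ k))) a (product s)) ⟩
      ∑ (sublists as) (λ s → a * (𝟙 (does (length s ≟ k)) * product s))
        ≡⟨ ∑-*ˡ (sublists as) a _ ⟩
      a * ∑ (sublists as) (λ s → 𝟙 (does (length s ≟ k)) * product s)
        ≡⟨ cong (a *_) (∑-sublists k as) ⟩
      a * esym k as ∎))
    where open ≡-Reasoning

esym-↭ : ∀ {xs ys} → xs ↭ ys → ∀ k → esym k xs ≡ esym k ys
esym-↭ ↭-refl            k             = refl
esym-↭ (↭-trans p q)     k             = trans (esym-↭ p k) (esym-↭ q k)
esym-↭ (prep a p)        zero          = refl
esym-↭ (prep a p)        (suc k)       = cong₂ (λ u v → u + a * v) (esym-↭ p (suc k)) (esym-↭ p k)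
esym-↭ (swap a b p)      zero          = refl
esym-↭ (swap a b p)      (suc zero)    rewrite esym-↭ p 1 =
  solve 3 (λ e a b → e :+ b :* con 1 :+ a :* con 1 := e :+ a :* con 1 :+ b :* con 1) refl _ a b
esym-↭ (swap a b p)      (suc (suc k)) rewrite esym-↭ p (2 + k) | esym-↭ p (suc k) | esym-↭ p k =
  solve 5 (λ e₂ e₁ e₀ a b → e₂ :+ b :* e₁ :+ a :* (e₁ :+ b :* e₀) := e₂ :+ a :* e₁ :+ b :* (e₁ :+ a :* e₀))
        refl _ _ _ a b

-- The cyclic order ≺[ A ] and inversion triples

-- isInversion does not look at the filling, so any module arguments will do.
inversion : ℕ → ℕ → ℕ → Bool
inversion = Filling.isInversion 0 [] [] []

ltK : ℕ × ℕ → ℕ × ℕ → Bool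
ltK = Filling.ltK 0 [] [] []

-- v ≺[ A ] u: v comes before u in the order A + 1 < A + 2 < ⋯ < 0 < 1 < ⋯ < A.
data _≺[_]_ (v A u : ℕ) : Set where
  above  : A < v → v < u → v ≺[ A ] u
  below  : v < u → u ≤ A → v ≺[ A ] u
  across : u ≤ A → A < v → v ≺[ A ] u

T-ltK : ∀ {x y i j} → T (ltK (x , i) (y , j)) ⇔ (x < y ⊎ (x ≡ y × i < j))
T-ltK {x} {y} {i} {j} = mk⇔ to from
  where
  to : T (ltK (x , i) (y , j)) → x < y ⊎ (x ≡ y × i < j)
  to t with Equivalence.to T-∨ t
  ... | inj₁ x<y = inj₁ (<ᵇ⇒< x y x<y)
  ... | inj₂ t′  with Equivalence.to (T-∧ {x ≡ᵇ y}) t′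
  ...   | x≡y , i<j = inj₂ (≡ᵇ⇒≡ x y x≡y , <ᵇ⇒< i j i<j)
  from : x < y ⊎ (x ≡ y × i < j) → T (ltK (x , i) (y , j))
  from (inj₁ x<y)         = Equivalence.from T-∨ (inj₁ (<⇒<ᵇ x<y))
  from (inj₂ (refl , i<j)) = Equivalence.from T-∨ (inj₂ (Equivalence.from T-∧ (≡⇒≡ᵇ x x refl , <⇒<ᵇ i<j)))

private
  ltK-3-2 : ∀ {x y} → T (ltK (x , 3) (y , 2)) ⇔ x < y
  ltK-3-2 {x} {y} = mk⇔ (λ t → [ id , (λ { (_ , s≤s (s≤s ())) }) ]′ (Equivalence.to (T-ltK {x} {y} {3} {2}) t))
                        (λ x<y → Equivalence.from (T-ltK {x} {y} {3} {2}) (inj₁ x<y))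

  ltK-2-1 : ∀ {x y} → T (ltK (x , 2) (y , 1)) ⇔ x < y
  ltK-2-1 {x} {y} = mk⇔ (λ t → [ id , (λ { (_ , s≤s ()) }) ]′ (Equivalence.to (T-ltK {x} {y} {2} {1}) t))
                        (λ x<y → Equivalence.from (T-ltK {x} {y} {2} {1}) (inj₁ x<y))

  ltK-1-3 : ∀ {x y} → T (ltK (x , 1) (y , 3)) ⇔ x ≤ y
  ltK-1-3 {x} {y} = mk⇔ (λ t → [ <⇒≤ , (λ { (x≡y , _) → ≤-reflexive x≡y }) ]′ (Equivalence.to (T-ltK {x} {y} {1} {3}) t))
                        (λ x≤y → Equivalence.from (T-ltK {x} {y} {1} {3})
                                   ([ inj₁ , (λ x≡y → inj₂ (x≡y , s≤s (s≤s z≤n))) ]′ (m≤n⇒m<n∨m≡n x≤y)))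

inversion⇔≺ : ∀ {A B C} → T (inversion A B C) ⇔ C ≺[ A ] B
inversion⇔≺ {A} {B} {C} = mk⇔ to from
  where
  AC CB BA : Bool
  AC = ltK (A , 3) (C , 2)
  CB = ltK (C , 2) (B , 1)
  BA = ltK (B , 1) (A , 3)
  both : ∀ {x y} → T x → T y → T (x ∧ y)
  both p q = Equivalence.from T-∧ (p , q)
  to : T (inversion A B C) → C ≺[ A ] B
  to t with Equivalence.to (T-∨ {AC ∧ CB}) t
  ... | inj₁ t₁ with Equivalence.to (T-∧ {AC}) t₁
  ...   | p , q = above (Equivalence.to ltK-3-2 p) (Equivalence.to ltK-2-1 q)
  to t | inj₂ t₂ with Equivalence.to (T-∨ {CB ∧ BA}) t₂
  ...   | inj₁ t₃ with Equivalence.to (T-∧ {CB}) t₃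
  ...     | p , q = below (Equivalence.to ltK-2-1 p) (Equivalence.to ltK-1-3 q)
  to t | inj₂ t₂ | inj₂ t₃ with Equivalence.to (T-∧ {BA}) t₃
  ...     | p , q = across (Equivalence.to ltK-1-3 p) (Equivalence.to ltK-3-2 q)
  from : C ≺[ A ] B → T (inversion A B C)
  from (above p q)  = Equivalence.from (T-∨ {AC ∧ CB}) (inj₁
    (both (Equivalence.from ltK-3-2 p) (Equivalence.from ltK-2-1 q)))
  from (below p q)  = Equivalence.from (T-∨ {AC ∧ CB}) (inj₂ (Equivalence.from (T-∨ {CB ∧ BA}) (inj₁
    (both (Equivalence.from ltK-2-1 p) (Equivalence.from ltK-1-3 q)))))
  from (across p q) = Equivalence.from (T-∨ {AC ∧ CB}) (inj₂ (Equivalence.from (T-∨ {CB ∧ BA}) (inj₂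
    (both (Equivalence.from ltK-1-3 p) (Equivalence.from ltK-3-2 q)))))

_≺?[_]_ : ∀ v A u → Dec (v ≺[ A ] u)
v ≺?[ A ] u = map′ (Equivalence.to inversion⇔≺) (Equivalence.from inversion⇔≺) (T? (inversion A u v))

≺-irrefl : ∀ {A v} → ¬ v ≺[ A ] v
≺-irrefl (above _ v<v)    = <-irrefl refl v<v
≺-irrefl (below v<v _)    = <-irrefl refl v<v
≺-irrefl (across v≤A A<v) = <⇒≱ A<v v≤A

≺-trans : ∀ {A w v u} → w ≺[ A ] v → v ≺[ A ] u → w ≺[ A ] u
≺-trans (above A<w w<v)  (above _ v<u)    = above A<w (<-trans w<v v<u)
≺-trans (above A<w w<v)  (below v<u u≤A)  = ⊥-elim (<⇒≱ (<-trans A<w (<-trans w<v v<u)) u≤A)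
≺-trans (above A<w _)    (across u≤A _)   = across u≤A A<w
≺-trans (below _ v≤A)    (above A<v _)    = ⊥-elim (<⇒≱ A<v v≤A)
≺-trans (below w<v _)    (below v<u u≤A)  = below (<-trans w<v v<u) u≤A
≺-trans (below _ v≤A)    (across _ A<v)   = ⊥-elim (<⇒≱ A<v v≤A)
≺-trans (across v≤A _)   (above A<v _)    = ⊥-elim (<⇒≱ A<v v≤A)
≺-trans (across _ A<w)   (below _ u≤A)    = across u≤A A<w
≺-trans (across v≤A _)   (across _ A<v)   = ⊥-elim (<⇒≱ A<v v≤A)

≺-asym : ∀ {A v u} → v ≺[ A ] u → ¬ u ≺[ A ] v
≺-asym v≺u u≺v = ≺-irrefl (≺-trans v≺u u≺v)

≺-connex : ∀ A {v u} → v ≢ u → v ≺[ A ] u ⊎ u ≺[ A ] v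
≺-connex A {v} {u} v≢u with A <? v | A <? u | <-cmp v u
... | _       | _       | tri≈ _ v≡u _ = ⊥-elim (v≢u v≡u)
... | yes A<v | yes A<u | tri< v<u _ _ = inj₁ (above A<v v<u)
... | yes A<v | yes A<u | tri> _ _ u<v = inj₂ (above A<u u<v)
... | yes A<v | no  A≮u | _            = inj₁ (across (≮⇒≥ A≮u) A<v)
... | no  A≮v | yes A<u | _            = inj₂ (across (≮⇒≥ A≮v) A<u)
... | no  A≮v | no  A≮u | tri< v<u _ _ = inj₁ (below v<u (≮⇒≥ A≮u))
... | no  A≮v | no  A≮u | tri> _ _ u<v = inj₂ (below u<v (≮⇒≥ A≮v))

≺⇒≢ : ∀ {A v u} → v ≺[ A ] u → v ≢ u
≺⇒≢ v≺v refl = ≺-irrefl v≺v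

≺⇒≢cut : ∀ {A v u} → v ≺[ A ] u → v ≢ A
≺⇒≢cut (above A<A _)  refl = <-irrefl refl A<A
≺⇒≢cut (below A<u u≤A) refl = <⇒≱ A<u u≤A
≺⇒≢cut (across _ A<A) refl = <-irrefl refl A<A

-- Grouping subsets by their largest element

≺-maximum : ∀ A u us → Unique (u ∷ us) →
  ∃₂ λ m U′ → (u ∷ us ↭ m ∷ U′) × All (_≺[ A ] m) U′ × Unique U′
≺-maximum A u []        _            = u , [] , ↭-refl , [] , []
≺-maximum A u (u₂ ∷ us) (u∉ ∷ u₂∷us!) with ≺-maximum A u₂ us u₂∷us!
... | m , U′ , p , U′≺m , U′! with All-resp-↭ p u∉
...   | u≢m ∷ u∉U′ with ≺-connex A u≢m
...     | inj₁ u≺m = m , u ∷ U′ , ↭-trans (prep u p) (swap u m ↭-refl) , u≺m ∷ U′≺m , u∉U′ ∷ U′!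
...     | inj₂ m≺u = u , u₂ ∷ us , ↭-refl
                   , All-resp-↭ (↭-sym p) (m≺u ∷ All.map (λ v≺m → ≺-trans v≺m m≺u) U′≺m) , u₂∷us!

predecessors : ℕ → ℕ → List ℕ → List ℕ
predecessors A u = filter (λ v → v ≺?[ A ] u)

module _ (A : ℕ) (y : ℕ → ℕ) (h : ℕ) where

  private
    term : List ℕ → ℕ → ℕ
    term L v = y v * esym h (map y (predecessors A v L))

    term-↭ : ∀ {L M} → L ↭ M → ∀ v → term L v ≡ term M v
    term-↭ L↭M v = cong (y v *_) (esym-↭ (map⁺-↭ y (filter-↭ (λ w → w ≺?[ A ] v) L↭M)) h)

  -- Grouping the h+1-subsets by their ≺[ A ]-largest element.
  ∑-predecessors : ∀ U → Unique U → ∑ U (λ u → y u * esym h (map y (predecessors A u U))) ≡ esym (suc h) (map y U)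
  ∑-predecessors U = go (length U) U refl
    where
    go : ∀ n U → length U ≡ n → Unique U → ∑ U (term U) ≡ esym (suc h) (map y U)
    go zero    []       _   _  = refl
    go (suc n) (u ∷ us) len U! with ≺-maximum A u us U!
    ... | m , U′ , p , U′≺m , U′! = begin
      ∑ (u ∷ us) (term (u ∷ us))        ≡⟨ sum-↭ (map⁺-↭ (term (u ∷ us)) p) ⟩
      ∑ (m ∷ U′) (term (u ∷ us))        ≡⟨ ∑-cong (m ∷ U′) (term-↭ p) ⟩
      term (m ∷ U′) m + ∑ U′ (term (m ∷ U′))
        ≡⟨ cong₂ _+_ (cong (λ L → y m * esym h (map y L)) top) (∑-cong-local (All.map lower U′≺m)) ⟩
      y m * esym h (map y U′) + ∑ U′ (term U′)
        ≡⟨ cong (y m * esym h (map y U′) +_) (go n U′ (suc-injective (trans (sym (↭-length p)) len)) U′!) ⟩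
      y m * esym h (map y U′) + esym (suc h) (map y U′)
        ≡⟨ +-comm _ (esym (suc h) (map y U′)) ⟩
      esym (suc h) (map y (m ∷ U′))     ≡⟨ esym-↭ (map⁺-↭ y (↭-sym p)) (suc h) ⟩
      esym (suc h) (map y (u ∷ us))     ∎
      where
      open ≡-Reasoning
      top : predecessors A m (m ∷ U′) ≡ U′
      top = trans (filter-reject (λ v → v ≺?[ A ] m) ≺-irrefl) (filter-all (λ v → v ≺?[ A ] m) U′≺m)
      lower : ∀ {v} → v ≺[ A ] m → term (m ∷ U′) v ≡ term U′ v
      lower v≺m = cong (λ L → y _ * esym h (map y L)) (filter-reject (λ w → w ≺?[ A ] _) (≺-asym v≺m))

wordsOver : {A : Set} → List A → ℕ → List (List A)
wordsOver U zero    = [] ∷ []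
wordsOver U (suc k) = concatMap (λ a → map (a ∷_) (wordsOver U k)) U

module _ {A : Set} where

  ∑-wordsOver-suc : ∀ (U : List A) k (g : List A → ℕ) →
    ∑ (wordsOver U (suc k)) g ≡ ∑ U (λ a → ∑ (wordsOver U k) (λ w → g (a ∷ w)))
  ∑-wordsOver-suc U k g = trans (∑-concatMap _ U g) (∑-cong U (λ a → ∑-map (a ∷_) (wordsOver U k) g))

  ∑-wordsOver-all : {P : A → Set} (P? : ∀ a → Dec (P a)) (U : List A) (k : ℕ) (g : List A → ℕ) →
    ∑ (wordsOver U k) (λ w → 𝟙 (all (does ∘ P?) w) * g w) ≡ ∑ (wordsOver (filter P? U) k) g
  ∑-wordsOver-all P? U zero    g = cong (_+ 0) (+-identityʳ (g []))
  ∑-wordsOver-all P? U (suc k) g = begin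
    ∑ (wordsOver U (suc k)) (λ w → 𝟙 (all (does ∘ P?) w) * g w)
      ≡⟨ ∑-wordsOver-suc U k _ ⟩
    ∑ U (λ a → ∑ (wordsOver U k) (λ w → 𝟙 (does (P? a) ∧ all (does ∘ P?) w) * g (a ∷ w)))
      ≡⟨ ∑-cong U (λ a → trans (∑-cong (wordsOver U k) (λ w → split (does (P? a)) (all (does ∘ P?) w) (g (a ∷ w))))
                               (∑-*ˡ (wordsOver U k) (𝟙 (does (P? a))) _)) ⟩
    ∑ U (λ a → 𝟙 (does (P? a)) * ∑ (wordsOver U k) (λ w → 𝟙 (all (does ∘ P?) w) * g (a ∷ w)))
      ≡⟨ ∑-cong U (λ a → cong (𝟙 (does (P? a)) *_) (∑-wordsOver-all P? U k (λ w → g (a ∷ w)))) ⟩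
    ∑ U (λ a → 𝟙 (does (P? a)) * ∑ (wordsOver (filter P? U) k) (λ w → g (a ∷ w)))
      ≡⟨ ∑-filter P? U _ ⟨
    ∑ (filter P? U) (λ a → ∑ (wordsOver (filter P? U) k) (λ w → g (a ∷ w)))
      ≡⟨ ∑-wordsOver-suc (filter P? U) k g ⟨
    ∑ (wordsOver (filter P? U) (suc k)) g ∎
    where
    open ≡-Reasoning
    split : ∀ b c x → 𝟙 (b ∧ c) * x ≡ 𝟙 b * (𝟙 c * x)
    split b c x = trans (cong (_* x) (𝟙-∧ b c)) (*-assoc (𝟙 b) (𝟙 c) x)

columnOk : List ℕ → List ℕ → Bool
columnOk β []       = true
columnOk β (b ∷ bs) = all (λ v → does (v ≺?[ lookupD 0 β 0 ] b)) bs ∧ columnOk (drop 1 β) bs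

ColumnOk : List ℕ → List ℕ → Set
ColumnOk β b = ∀ {r r′} → r < r′ → r′ < length b → lookupD 0 b r′ ≺[ lookupD 0 β r ] lookupD 0 b r

T-columnOk : ∀ β b → T (columnOk β b) ⇔ ColumnOk β b
T-columnOk β b = mk⇔ (to β b) (from β b)
  where
  to : ∀ β b → T (columnOk β b) → ColumnOk β b
  to β (x ∷ bs) ok {zero}  {suc r′} _ (s≤s r′<n) =
    Equivalence.to inversion⇔≺ (All-lookupD 0 (All.all⁺ _ bs (proj₁ (Equivalence.to T-∧ ok))) r′<n)
  to β (x ∷ bs) ok {suc r} {suc r′} (s≤s r<r′) (s≤s r′<n) =
    subst (λ a → lookupD 0 bs r′ ≺[ a ] lookupD 0 bs r) (lookupD-drop-1 0 β r)
      (to (drop 1 β) bs (proj₂ (Equivalence.to (T-∧ {all _ bs}) ok)) r<r′ r′<n)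
  from : ∀ β b → ColumnOk β b → T (columnOk β b)
  from β []       _  = _
  from β (x ∷ bs) ok = Equivalence.from T-∧
    ( All.all⁻ _ (All-lookupD⁻ 0 bs (λ i<n → Equivalence.from inversion⇔≺ (ok z<s (s<s i<n))))
    , from (drop 1 β) bs (λ {r} r<r′ r′<n →
        subst (λ a → lookupD 0 bs _ ≺[ a ] lookupD 0 bs r) (sym (lookupD-drop-1 0 β r)) (ok (s<s r<r′) (s<s r′<n))))

∑-columnOk : ∀ (y : ℕ → ℕ) h U β → Unique U →
  ∑ (wordsOver U h) (λ b → 𝟙 (columnOk β b) * ∏ b y) ≡ esym h (map y U)
∑-columnOk y zero    U β U! = refl
∑-columnOk y (suc h) U β U! = begin
  ∑ (wordsOver U (suc h)) (λ b → 𝟙 (columnOk β b) * ∏ b y)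
    ≡⟨ ∑-wordsOver-suc U h _ ⟩
  ∑ U (λ a → ∑ (wordsOver U h) (λ w → 𝟙 (all (does ∘ before a) w ∧ columnOk β′ w) * (y a * ∏ w y)))
    ≡⟨ ∑-cong U (λ a → trans (∑-cong (wordsOver U h) (λ w → rearrange (all (does ∘ before a) w) (columnOk β′ w) (y a) (∏ w y)))
                             (∑-*ˡ (wordsOver U h) (y a) _)) ⟩
  ∑ U (λ a → y a * ∑ (wordsOver U h) (λ w → 𝟙 (all (does ∘ before a) w) * (𝟙 (columnOk β′ w) * ∏ w y)))
    ≡⟨ ∑-cong U (λ a → cong (y a *_) (∑-wordsOver-all (before a) U h _)) ⟩
  ∑ U (λ a → y a * ∑ (wordsOver (predecessors A a U) h) (λ w → 𝟙 (columnOk β′ w) * ∏ w y))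
    ≡⟨ ∑-cong U (λ a → cong (y a *_) (∑-columnOk y h (predecessors A a U) β′ (Unique.filter⁺ (before a) U!))) ⟩
  ∑ U (λ a → y a * esym h (map y (predecessors A a U)))
    ≡⟨ ∑-predecessors A y h U U! ⟩
  esym (suc h) (map y U) ∎
  where
  open ≡-Reasoning
  A : ℕ
  A = lookupD 0 β 0
  β′ : List ℕ
  β′ = drop 1 β
  before : ∀ a v → Dec (v ≺[ A ] a)
  before a v = v ≺?[ A ] a
  rearrange : ∀ b c x p → 𝟙 (b ∧ c) * (x * p) ≡ x * (𝟙 b * (𝟙 c * p))
  rearrange b c x p rewrite 𝟙-∧ b c = solve 4 (λ i j x p → i :* j :* (x :* p) := x :* (i :* (j :* p))) refl (𝟙 b) (𝟙 c) x p

-- Partitions and their conjugates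

parts> : ℕ → List ℕ → ℕ
parts> j s = length (filter (λ p → suc j ≤? p) s)

height : List ℕ → ℕ
height = parts> 0

largest : List ℕ → ℕ
largest = foldr _⊔_ 0

height≤length : ∀ s → height s ≤ length s
height≤length = length-filter (λ p → 1 ≤? p)

Decreasing-tail : ∀ {a s} → Decreasing (a ∷ s) → Decreasing s
Decreasing-tail [-]     = []
Decreasing-tail (_ ∷ d) = d

Decreasing-pred : ∀ {s} → Decreasing s → Decreasing (map pred s)
Decreasing-pred []        = []
Decreasing-pred [-]       = [-]
Decreasing-pred (b≤a ∷ d) = pred-mono-≤ b≤a ∷ Decreasing-pred d

Decreasing-0∷⇒zeros : ∀ {s} → Decreasing (0 ∷ s) → All (_≡ 0) s
Decreasing-0∷⇒zeros [-]       = []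
Decreasing-0∷⇒zeros (z≤n ∷ d) = refl ∷ Decreasing-0∷⇒zeros d

map-pred-zeros : ∀ {s} → All (_≡ 0) s → map pred s ≡ s
map-pred-zeros []         = refl
map-pred-zeros (refl ∷ z) = cong (0 ∷_) (map-pred-zeros z)

height-zeros : ∀ {s} → All (_≡ 0) s → height s ≡ 0
height-zeros []         = refl
height-zeros (refl ∷ z) = height-zeros z

Decreasing-lookupD : ∀ {s} → Decreasing s → ∀ {i j} → i ≤ j → lookupD 0 s j ≤ lookupD 0 s i
Decreasing-lookupD []        _                 = z≤n
Decreasing-lookupD [-]       {zero}  {zero}  _ = ≤-refl
Decreasing-lookupD [-]       {zero}  {suc j} _ = z≤n
Decreasing-lookupD [-]       {suc i} {suc j} _ = z≤n
Decreasing-lookupD (b≤a ∷ d) {zero}  {zero}  _ = ≤-refl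
Decreasing-lookupD (b≤a ∷ d) {zero}  {suc j} _ = ≤-trans (Decreasing-lookupD d {zero} {j} z≤n) b≤a
Decreasing-lookupD (b≤a ∷ d) {suc i} {suc j} (s≤s i≤j) = Decreasing-lookupD d i≤j

positive⇒<height : ∀ {s} → Decreasing s → ∀ {r} → 0 < lookupD 0 s r → r < height s
positive⇒<height {suc l ∷ s} d {zero}  _   = z<s
positive⇒<height {suc l ∷ s} d {suc r} pos = s<s (positive⇒<height (Decreasing-tail d) pos)
positive⇒<height {zero ∷ s}  d {suc r} pos = ⊥-elim (<⇒≱ pos (Decreasing-lookupD d {zero} {suc r} z≤n))

<height⇒positive : ∀ {s} → Decreasing s → ∀ {r} → r < height s → 0 < lookupD 0 s r
<height⇒positive {suc l ∷ s} d {zero}  _         = z<s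
<height⇒positive {suc l ∷ s} d {suc r} (s≤s r<h) = <height⇒positive (Decreasing-tail d) r<h
<height⇒positive {zero ∷ s}  d {r}     r<h       =
  ⊥-elim (<⇒≱ r<h (≤-trans (≤-reflexive (height-zeros (Decreasing-0∷⇒zeros d))) z≤n))

lookupD-map-pred : ∀ s r → lookupD 0 (map pred s) r ≡ pred (lookupD 0 s r)
lookupD-map-pred []      r       = refl
lookupD-map-pred (p ∷ s) zero    = refl
lookupD-map-pred (p ∷ s) (suc r) = lookupD-map-pred s r

<-lookupD-map-pred : ∀ s {r c} → c < lookupD 0 (map pred s) r ⇔ suc c < lookupD 0 s r
<-lookupD-map-pred s {r} {c} = mk⇔ (λ c<s⁻ → <pred⇒suc< (subst (c <_) (lookupD-map-pred s r) c<s⁻))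
                                   (λ c+1<s → subst (c <_) (sym (lookupD-map-pred s r)) (pred-mono-≤ c+1<s))
  where
  <pred⇒suc< : ∀ {c x} → c < pred x → suc c < x
  <pred⇒suc< {x = suc x} c<x = s<s c<x

lookupD-zeros : ∀ {s} → All (_≡ 0) s → ∀ r → lookupD 0 s r ≡ 0
lookupD-zeros []         r       = refl
lookupD-zeros (refl ∷ _) zero    = refl
lookupD-zeros (_ ∷ z)    (suc r) = lookupD-zeros z r

parts>-pred : ∀ j s → parts> (suc j) s ≡ parts> j (map pred s)
parts>-pred j []          = refl
parts>-pred j (zero ∷ s)  = parts>-pred j s
parts>-pred j (suc p ∷ s) with does (suc j ≤? p)
... | true  = cong suc (parts>-pred j s)
... | false = parts>-pred j s

largest-pred : ∀ s → largest (map pred s) ≡ pred (largest s)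
largest-pred []      = refl
largest-pred (p ∷ s) = trans (cong (pred p ⊔_) (largest-pred s)) (pred-⊔ p (largest s))
  where
  pred-⊔ : ∀ a b → pred a ⊔ pred b ≡ pred (a ⊔ b)
  pred-⊔ zero    b       = refl
  pred-⊔ (suc a) zero    = ⊔-identityʳ a
  pred-⊔ (suc a) (suc b) = refl

largest-zeros : ∀ s → largest s ≡ 0 → All (_≡ 0) s
largest-zeros []      _ = []
largest-zeros (p ∷ s) e = m⊔n≡0⇒m≡0 e ∷ largest-zeros s (m⊔n≡0⇒n≡0 e)
  where
  m⊔n≡0⇒m≡0 : ∀ {m n} → m ⊔ n ≡ 0 → m ≡ 0
  m⊔n≡0⇒m≡0 e = n≤0⇒n≡0 (≤-trans (m≤m⊔n _ _) (≤-reflexive e))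
  m⊔n≡0⇒n≡0 : ∀ {m n} → m ⊔ n ≡ 0 → n ≡ 0
  m⊔n≡0⇒n≡0 e = n≤0⇒n≡0 (≤-trans (m≤n⊔m _ _) (≤-reflexive e))

conjugate-largest-zero : ∀ s → largest s ≡ 0 → conjugate s ≡ []
conjugate-largest-zero s e = cong (λ m → map (λ j → parts> j s) (upTo m)) e

conjugate-step : ∀ s k → largest s ≡ suc k → conjugate s ≡ height s ∷ conjugate (map pred s)
conjugate-step s k e = begin
  map (λ j → parts> j s) (upTo (largest s))          ≡⟨ cong (λ m → map (λ j → parts> j s) (upTo m)) e ⟩
  height s ∷ map (λ j → parts> j s) (applyUpTo suc k) ≡⟨ cong (height s ∷_) shift ⟩
  height s ∷ map (λ j → parts> j (map pred s)) (upTo k)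
    ≡⟨ cong (λ m → height s ∷ map (λ j → parts> j (map pred s)) (upTo m)) (trans (sym (cong pred e)) (sym (largest-pred s))) ⟩
  height s ∷ conjugate (map pred s) ∎
  where
  open ≡-Reasoning
  shift : map (λ j → parts> j s) (applyUpTo suc k) ≡ map (λ j → parts> j (map pred s)) (upTo k)
  shift = begin
    map (λ j → parts> j s) (applyUpTo suc k)     ≡⟨ map-applyUpTo suc (λ j → parts> j s) k ⟩
    applyUpTo (λ j → parts> (suc j) s) k         ≡⟨ map-applyUpTo (λ j → j) (λ j → parts> (suc j) s) k ⟨
    map (λ j → parts> (suc j) s) (upTo k)        ≡⟨ map-cong (λ j → parts>-pred j s) (upTo k) ⟩
    map (λ j → parts> j (map pred s)) (upTo k)   ∎

Decreasing-replicate-0 : ∀ m → Decreasing (replicate m 0)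
Decreasing-replicate-0 zero          = []
Decreasing-replicate-0 (suc zero)    = [-]
Decreasing-replicate-0 (suc (suc m)) = z≤n ∷ Decreasing-replicate-0 (suc m)

Decreasing-++-zeros : ∀ {l} → Decreasing l → ∀ m → Decreasing (l ++ replicate m 0)
Decreasing-++-zeros []          m       = Decreasing-replicate-0 m
Decreasing-++-zeros [-]         zero    = [-]
Decreasing-++-zeros [-]         (suc m) = z≤n ∷ Decreasing-replicate-0 (suc m)
Decreasing-++-zeros (b≤a ∷ d)   m       = b≤a ∷ Decreasing-++-zeros d m

largest-++-zeros : ∀ l m → largest (l ++ replicate m 0) ≡ largest l
largest-++-zeros []      zero    = refl
largest-++-zeros []      (suc m) = largest-++-zeros [] m
largest-++-zeros (a ∷ l) m       = cong (a ⊔_) (largest-++-zeros l m)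

parts>-++-zeros : ∀ j l m → parts> j (l ++ replicate m 0) ≡ parts> j l
parts>-++-zeros j []      zero    = refl
parts>-++-zeros j []      (suc m) = parts>-++-zeros j [] m
parts>-++-zeros j (p ∷ l) m with does (suc j ≤? p)
... | true  = cong suc (parts>-++-zeros j l m)
... | false = parts>-++-zeros j l m

conjugate-pad : ∀ n l → conjugate (pad n l) ≡ conjugate l
conjugate-pad n l = begin
  map (λ j → parts> j (pad n l)) (upTo (largest (pad n l)))
    ≡⟨ cong (λ m → map (λ j → parts> j (pad n l)) (upTo m)) (largest-++-zeros l _) ⟩
  map (λ j → parts> j (pad n l)) (upTo (largest l))
    ≡⟨ map-cong (λ j → parts>-++-zeros j l _) (upTo (largest l)) ⟩
  map (λ j → parts> j l) (upTo (largest l)) ∎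
  where open ≡-Reasoning

length-pad : ∀ n l → length l ≤ n → length (pad n l) ≡ n
length-pad n l l≤n = trans (length-++ l) (trans (cong (length l +_) (length-replicate (n ∸ length l) {0})) (m+[n∸m]≡n l≤n))

-- Fillings column by column

alphabet : ℕ → List ℕ
alphabet n = map suc (upTo n)

alphabet-unique : ∀ n → Unique (alphabet n)
alphabet-unique n = Unique.map⁺ suc-injective (Unique.upTo⁺ n)

words≡wordsOver : ∀ n k → words n k ≡ wordsOver (alphabet n) k
words≡wordsOver n zero    = refl
words≡wordsOver n (suc k) = cong (λ W → concatMap (λ a → map (a ∷_) W) (alphabet n)) (words≡wordsOver n k)

∑-fillings-∷ : ∀ n l s (g : List (List ℕ) → ℕ) →
  ∑ (fillings n (l ∷ s)) g ≡ ∑ (wordsOver (alphabet n) l) (λ w → ∑ (fillings n s) (λ rows → g (w ∷ rows)))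
∑-fillings-∷ n l s g = begin
  ∑ (fillings n (l ∷ s)) g
    ≡⟨ ∑-concatMap _ (words n l) g ⟩
  ∑ (words n l) (λ w → ∑ (map (w ∷_) (fillings n s)) g)
    ≡⟨ ∑-cong (words n l) (λ w → ∑-map (w ∷_) (fillings n s) g) ⟩
  ∑ (words n l) (λ w → ∑ (fillings n s) (λ rows → g (w ∷ rows)))
    ≡⟨ cong (λ W → ∑ W (λ w → ∑ (fillings n s) (λ rows → g (w ∷ rows)))) (words≡wordsOver n l) ⟩
  ∑ (wordsOver (alphabet n) l) (λ w → ∑ (fillings n s) (λ rows → g (w ∷ rows))) ∎
  where open ≡-Reasoning

_HasShape_ : List (List ℕ) → List ℕ → Set
rows HasShape s = Pointwise (λ w l → length w ≡ l) rows s

wordsOver-length : ∀ {A : Set} (U : List A) k → All (λ w → length w ≡ k) (wordsOver U k)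
wordsOver-length U zero    = refl ∷ []
wordsOver-length U (suc k) =
  All.concat⁺ (All.map⁺ (All.universal (λ a → All.map⁺ (All.map (cong suc) (wordsOver-length U k))) U))

fillings-shape : ∀ n s → All (_HasShape s) (fillings n s)
fillings-shape n []      = [] ∷ []
fillings-shape n (l ∷ s) =
  All.concat⁺ (All.map⁺ (All.map (λ |w|≡l → All.map⁺ (All.map (|w|≡l ∷_) (fillings-shape n s))) words-length))
  where
  words-length : All (λ w → length w ≡ l) (words n l)
  words-length = subst (All (λ w → length w ≡ l)) (sym (words≡wordsOver n l)) (wordsOver-length (alphabet n) l)

∑-fillings-zeros : ∀ n {s} → All (_≡ 0) s → (g : List (List ℕ) → ℕ) → ∑ (fillings n s) g ≡ g (map (λ _ → []) s)
∑-fillings-zeros n []             g = +-identityʳ _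
∑-fillings-zeros n {0 ∷ s} (refl ∷ z) g =
  trans (∑-fillings-∷ n 0 s g) (trans (+-identityʳ _) (∑-fillings-zeros n z (λ rows → g ([] ∷ rows))))

HasShape-lookupD : ∀ {rows s} → rows HasShape s → ∀ r → length (lookupD [] rows r) ≡ lookupD 0 s r
HasShape-lookupD []            r       = refl
HasShape-lookupD (|w| ∷ _)     zero    = |w|
HasShape-lookupD (_ ∷ shape)   (suc r) = HasShape-lookupD shape r

prependColumn : List ℕ → List (List ℕ) → List (List ℕ)
prependColumn []       rows       = rows
prependColumn (b ∷ bs) []         = [ b ] ∷ prependColumn bs []
prependColumn (b ∷ bs) (w ∷ rows) = (b ∷ w) ∷ prependColumn bs rows

∑-fillings-column : ∀ n {s} → Decreasing s → (f : List (List ℕ) → ℕ) →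
  ∑ (fillings n s) f ≡ ∑ (wordsOver (alphabet n) (height s)) (λ b → ∑ (fillings n (map pred s)) (λ rows → f (prependColumn b rows)))
∑-fillings-column n {[]}        d f = sym (+-identityʳ _)
∑-fillings-column n {zero ∷ s}  d f
  rewrite map-pred-zeros (Decreasing-0∷⇒zeros d) | height-zeros (Decreasing-0∷⇒zeros d) = sym (+-identityʳ _)
∑-fillings-column n {suc l ∷ s} d f = begin
  ∑ (fillings n (suc l ∷ s)) f
    ≡⟨ ∑-fillings-∷ n (suc l) s f ⟩
  ∑ (wordsOver Σn (suc l)) (λ w → ∑ (fillings n s) (λ r → f (w ∷ r)))
    ≡⟨ ∑-wordsOver-suc Σn l _ ⟩
  ∑ Σn (λ a → ∑ Wₗ (λ w → ∑ (fillings n s) (λ r → f ((a ∷ w) ∷ r))))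
    ≡⟨ ∑-cong Σn (λ a → ∑-cong Wₗ (λ w → ∑-fillings-column n (Decreasing-tail d) _)) ⟩
  ∑ Σn (λ a → ∑ Wₗ (λ w → ∑ Wₕ (λ b → ∑ R (λ r → f (prependColumn (a ∷ b) (w ∷ r))))))
    ≡⟨ ∑-cong Σn (λ a → ∑-comm Wₗ Wₕ _) ⟩
  ∑ Σn (λ a → ∑ Wₕ (λ b → ∑ Wₗ (λ w → ∑ R (λ r → f (prependColumn (a ∷ b) (w ∷ r))))))
    ≡⟨ ∑-cong Σn (λ a → ∑-cong Wₕ (λ b → ∑-fillings-∷ n l (map pred s) _)) ⟨
  ∑ Σn (λ a → ∑ Wₕ (λ b → ∑ (fillings n (l ∷ map pred s)) (λ r → f (prependColumn (a ∷ b) r))))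
    ≡⟨ ∑-wordsOver-suc Σn (height s) _ ⟨
  ∑ (wordsOver Σn (suc (height s))) (λ b → ∑ (fillings n (l ∷ map pred s)) (λ r → f (prependColumn b r))) ∎
  where
  open ≡-Reasoning
  Σn : List ℕ
  Σn = alphabet n
  Wₗ Wₕ : List (List ℕ)
  Wₗ = wordsOver Σn l
  Wₕ = wordsOver Σn (height s)
  R : List (List (List ℕ))
  R = fillings n (map pred s)

firstColumn : ℕ → List (List ℕ) → List ℕ
firstColumn zero    _          = []
firstColumn (suc h) []         = []
firstColumn (suc h) (w ∷ rows) = lookupD 0 w 0 ∷ firstColumn h rows

restColumns : ℕ → List (List ℕ) → List (List ℕ)
restColumns zero    rows       = rows
restColumns (suc h) []         = []
restColumns (suc h) (w ∷ rows) = drop 1 w ∷ restColumns h rows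

firstColumn-prepend : ∀ b rows → firstColumn (length b) (prependColumn b rows) ≡ b
firstColumn-prepend []       rows       = refl
firstColumn-prepend (b ∷ bs) []         = cong (b ∷_) (firstColumn-prepend bs [])
firstColumn-prepend (b ∷ bs) (w ∷ rows) = cong (b ∷_) (firstColumn-prepend bs rows)

restColumns-prepend : ∀ b rows → length b ≤ length rows → restColumns (length b) (prependColumn b rows) ≡ rows
restColumns-prepend []       rows       _          = refl
restColumns-prepend (b ∷ bs) (w ∷ rows) (s≤s b≤rows) = cong (w ∷_) (restColumns-prepend bs rows b≤rows)

length-firstColumn : ∀ h rows → h ≤ length rows → length (firstColumn h rows) ≡ h
length-firstColumn zero    rows       _          = refl
length-firstColumn (suc h) (w ∷ rows) (s≤s h≤n)  = cong suc (length-firstColumn h rows h≤n)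

length-firstColumn≤ : ∀ h rows → length (firstColumn h rows) ≤ h
length-firstColumn≤ zero    rows       = z≤n
length-firstColumn≤ (suc h) []         = z≤n
length-firstColumn≤ (suc h) (w ∷ rows) = s≤s (length-firstColumn≤ h rows)

lookupD-firstColumn : ∀ {h} rows {r} → r < h → lookupD 0 (firstColumn h rows) r ≡ lookupD 0 (lookupD [] rows r) 0
lookupD-firstColumn {suc h} []         {r}     _         = refl
lookupD-firstColumn {suc h} (w ∷ rows) {zero}  _         = refl
lookupD-firstColumn {suc h} (w ∷ rows) {suc r} (s≤s r<h) = lookupD-firstColumn rows r<h

lookupD-restColumns : ∀ {h} rows {r} → r < h → lookupD [] (restColumns h rows) r ≡ drop 1 (lookupD [] rows r)
lookupD-restColumns {suc h} []         {r}     _         = refl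
lookupD-restColumns {suc h} (w ∷ rows) {zero}  _         = refl
lookupD-restColumns {suc h} (w ∷ rows) {suc r} (s≤s r<h) = lookupD-restColumns rows r<h

restColumns-shape : ∀ {s rows} → Decreasing s → rows HasShape s → restColumns (height s) rows HasShape map pred s
restColumns-shape {[]}        _ []                 = []
restColumns-shape {zero ∷ s}  d shape
  rewrite height-zeros (Decreasing-0∷⇒zeros d) | map-pred-zeros (Decreasing-0∷⇒zeros d) = shape
restColumns-shape {suc l ∷ s} d ((_∷_ {x = _ ∷ w} |w| shape)) =
  cong pred |w| ∷ restColumns-shape (Decreasing-tail d) shape

-- k is the number of columns, i.e. largest s; recursing on it keeps the recursion structural.
admissible : ℕ → List ℕ → List ℕ → List (List ℕ) → Bool
admissible zero    s β rows = true
admissible (suc k) s β rows =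
  columnOk β (firstColumn (height s) rows)
  ∧ admissible k (map pred s) (firstColumn (height s) rows) (restColumns (height s) rows)

admissible-prepend : ∀ k s β b rows → length b ≡ height s → length b ≤ length rows →
  admissible (suc k) s β (prependColumn b rows) ≡ (columnOk β b ∧ admissible k (map pred s) b rows)
admissible-prepend k s β b rows b≡h b≤rows
  rewrite sym b≡h | firstColumn-prepend b rows | restColumns-prepend b rows b≤rows = refl

monomialOf : (ℕ → ℕ) → List (List ℕ) → ℕ
monomialOf y rows = ∏ rows (λ w → ∏ w y)

monomialOf-prependColumn : ∀ (y : ℕ → ℕ) b rows → monomialOf y (prependColumn b rows) ≡ ∏ b y * monomialOf y rows
monomialOf-prependColumn y []       rows       = sym (+-identityʳ _)
monomialOf-prependColumn y (b ∷ bs) []         = trans (cong (y b * 1 *_) (monomialOf-prependColumn y bs []))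
  (solve 2 (λ a p → a :* con 1 :* (p :* con 1) := a :* p :* con 1) refl (y b) (∏ bs y))
monomialOf-prependColumn y (b ∷ bs) (w ∷ rows) = trans (cong (y b * ∏ w y *_) (monomialOf-prependColumn y bs rows))
  (solve 4 (λ a p c q → a :* c :* (p :* q) := a :* p :* (c :* q)) refl (y b) (∏ bs y) (∏ w y) (monomialOf y rows))

summand-prependColumn : ∀ (y : ℕ → ℕ) k s β b rows → length b ≡ height s → length b ≤ length rows →
  𝟙 (admissible (suc k) s β (prependColumn b rows)) * monomialOf y (prependColumn b rows)
  ≡ 𝟙 (columnOk β b) * ∏ b y * (𝟙 (admissible k (map pred s) b rows) * monomialOf y rows)
summand-prependColumn y k s β b rows b≡h b≤rows
  rewrite admissible-prepend k s β b rows b≡h b≤rows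
        | monomialOf-prependColumn y b rows
        | 𝟙-∧ (columnOk β b) (admissible k (map pred s) b rows) =
  solve 4 (λ i j p q → i :* j :* (p :* q) := i :* p :* (j :* q)) refl
    (𝟙 (columnOk β b)) (𝟙 (admissible k (map pred s) b rows)) (∏ b y) (monomialOf y rows)

monomialOf-empty-rows : ∀ (y : ℕ → ℕ) (s : List ℕ) → monomialOf y (map (λ _ → []) s) ≡ 1
monomialOf-empty-rows y []      = refl
monomialOf-empty-rows y (_ ∷ s) = trans (+-identityʳ _) (monomialOf-empty-rows y s)

module _ (n : ℕ) (y : ℕ → ℕ) where

  private
    e : ℕ → ℕ
    e h = esym h (map y (alphabet n))

  ∑-admissible : ∀ k {s} → Decreasing s → largest s ≡ k → ∀ β →
    ∑ (fillings n s) (λ rows → 𝟙 (admissible k s β rows) * monomialOf y rows) ≡ ∏ (conjugate s) e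
  ∑-admissible zero {s} _ s≤0 β = begin
    ∑ (fillings n s) (λ rows → 𝟙 true * monomialOf y rows) ≡⟨ ∑-fillings-zeros n (largest-zeros s s≤0) _ ⟩
    1 * monomialOf y (map (λ _ → []) s)                    ≡⟨ trans (*-identityˡ _) (monomialOf-empty-rows y s) ⟩
    1                                                      ≡⟨ cong (λ ν → ∏ ν e) (conjugate-largest-zero s s≤0) ⟨
    ∏ (conjugate s) e                                      ∎
    where open ≡-Reasoning
  ∑-admissible (suc k) {s} d s≡1+k β = begin
    ∑ (fillings n s) (λ rows → 𝟙 (admissible (suc k) s β rows) * monomialOf y rows)
      ≡⟨ ∑-fillings-column n d _ ⟩
    ∑ W (λ b → ∑ (fillings n s⁻) (λ r → 𝟙 (admissible (suc k) s β (prependColumn b r)) * monomialOf y (prependColumn b r)))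
      ≡⟨ ∑-cong-local (All.map (λ |b| → ∑-cong-local (All.map (split |b|) (fillings-shape n s⁻))) (wordsOver-length Σn h)) ⟩
    ∑ W (λ b → ∑ (fillings n s⁻) (λ r → column b * (𝟙 (admissible k s⁻ b r) * monomialOf y r)))
      ≡⟨ ∑-cong W (λ b → ∑-*ˡ (fillings n s⁻) (column b) _) ⟩
    ∑ W (λ b → column b * ∑ (fillings n s⁻) (λ r → 𝟙 (admissible k s⁻ b r) * monomialOf y r))
      ≡⟨ ∑-cong W (λ b → cong (column b *_) (∑-admissible k (Decreasing-pred d) (trans (largest-pred s) (cong pred s≡1+k)) b)) ⟩
    ∑ W (λ b → column b * ∏ (conjugate s⁻) e)
      ≡⟨ ∑-*ʳ W column _ ⟩
    ∑ W column * ∏ (conjugate s⁻) e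
      ≡⟨ cong (_* ∏ (conjugate s⁻) e) (∑-columnOk y h Σn β (alphabet-unique n)) ⟩
    e h * ∏ (conjugate s⁻) e
      ≡⟨ cong (λ ν → ∏ ν e) (conjugate-step s k s≡1+k) ⟨
    ∏ (conjugate s) e ∎
    where
    open ≡-Reasoning
    Σn : List ℕ
    Σn = alphabet n
    h : ℕ
    h = height s
    s⁻ : List ℕ
    s⁻ = map pred s
    W : List (List ℕ)
    W = wordsOver Σn h
    column : List ℕ → ℕ
    column b = 𝟙 (columnOk β b) * ∏ b y
    fits : ∀ {b r} → length b ≡ h → r HasShape s⁻ → length b ≤ length r
    fits |b| shape = ≤-trans (≤-reflexive |b|)
      (≤-trans (height≤length s) (≤-reflexive (trans (sym (length-map pred s)) (sym (Pointwise-length shape)))))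
    split : ∀ {b r} → length b ≡ h → r HasShape s⁻ →
      𝟙 (admissible (suc k) s β (prependColumn b r)) * monomialOf y (prependColumn b r)
      ≡ column b * (𝟙 (admissible k s⁻ b r) * monomialOf y r)
    split {b} {r} |b| shape = summand-prependColumn y k s β b r |b| (fits {b} |b| shape)

entry : List ℕ → List (List ℕ) → ℕ → ℕ → ℕ
entry β rows r zero    = lookupD 0 β r
entry β rows r (suc c) = lookupD 0 (lookupD [] rows r) c

-- Coinversion-freeness of a filling of partition shape s (which has no type B triples).
Admissible : List ℕ → List (List ℕ) → List ℕ → Set
Admissible β rows s = ∀ {r r′ c} → r < r′ → c < lookupD 0 s r′ →
  entry β rows r′ (suc c) ≺[ entry β rows r c ] entry β rows r (suc c)

entry-shift : ∀ β rows {h} r c → r < h →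
  entry β rows r (suc c) ≡ entry (firstColumn h rows) (restColumns h rows) r c
entry-shift β rows r zero    r<h = sym (lookupD-firstColumn rows r<h)
entry-shift β rows {h} r (suc c) r<h = begin
  lookupD 0 (lookupD [] rows r) (suc c)          ≡⟨ lookupD-drop-1 0 (lookupD [] rows r) c ⟨
  lookupD 0 (drop 1 (lookupD [] rows r)) c       ≡⟨ cong (λ w → lookupD 0 w c) (lookupD-restColumns rows r<h) ⟨
  lookupD 0 (lookupD [] (restColumns h rows) r) c ∎
  where open ≡-Reasoning

module _ {s : List ℕ} (β : List ℕ) (rows : List (List ℕ)) (d : Decreasing s) where

  private
    h : ℕ
    h = height s
    H : List ℕ
    H = firstColumn h rows
    R : List (List ℕ)
    R = restColumns h rows
    shift : ∀ r c → r < h → entry β rows r (suc c) ≡ entry H R r c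
    shift = entry-shift β rows
    below-height : ∀ {r′ c} → c < lookupD 0 s r′ → r′ < h
    below-height c<s = positive⇒<height d (≤-<-trans z≤n c<s)

  Admissible⇒columns : Admissible β rows s →
    ColumnOk β (firstColumn (height s) rows) × Admissible (firstColumn (height s) rows) (restColumns (height s) rows) (map pred s)
  Admissible⇒columns adm = column , rest
    where
    column : ColumnOk β H
    column {r} {r′} r<r′ r′<|H| =
      let r′<h = ≤-trans r′<|H| (length-firstColumn≤ h rows) in
      subst₂ (λ a b → a ≺[ lookupD 0 β r ] b) (shift r′ 0 r′<h) (shift r 0 (<-trans r<r′ r′<h))
        (adm r<r′ (<height⇒positive d r′<h))
    rest : Admissible H R (map pred s)
    rest {r} {r′} {c} r<r′ c<s⁻ =
      let c+1<s = Equivalence.to (<-lookupD-map-pred s) c<s⁻ ; r′<h = below-height c+1<s ; r<h = <-trans r<r′ r′<h in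
      subst₂ (λ a b → a ≺[ b ] entry H R r (suc c)) (shift r′ (suc c) r′<h) (shift r c r<h)
        (subst (λ a → entry β rows r′ (suc (suc c)) ≺[ entry β rows r (suc c) ] a) (shift r (suc c) r<h)
          (adm r<r′ c+1<s))

  columns⇒Admissible : rows HasShape s →
    ColumnOk β (firstColumn (height s) rows) × Admissible (firstColumn (height s) rows) (restColumns (height s) rows) (map pred s) →
    Admissible β rows s
  columns⇒Admissible shape (column , rest) {r} {r′} {zero} r<r′ 0<s =
    let r′<h = below-height 0<s ; r<h = <-trans r<r′ r′<h in
    subst₂ (λ a b → a ≺[ lookupD 0 β r ] b) (sym (shift r′ 0 r′<h)) (sym (shift r 0 r<h))
      (column r<r′ (subst (r′ <_) (sym (length-firstColumn h rows h≤rows)) r′<h))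
    where
    h≤rows : h ≤ length rows
    h≤rows = ≤-trans (height≤length s) (≤-reflexive (sym (Pointwise-length shape)))
  columns⇒Admissible shape (column , rest) {r} {r′} {suc c} r<r′ c<s =
    let r′<h = below-height c<s ; r<h = <-trans r<r′ r′<h in
    subst₂ (λ a b → a ≺[ b ] entry β rows r (suc (suc c))) (sym (shift r′ (suc c) r′<h)) (sym (shift r c r<h))
      (subst (λ a → entry H R r′ (suc c) ≺[ entry H R r c ] a) (sym (shift r (suc c) r<h))
        (rest r<r′ (Equivalence.from (<-lookupD-map-pred s) c<s)))

T-admissible : ∀ k {s} β rows → Decreasing s → largest s ≡ k → rows HasShape s →
  T (admissible k s β rows) ⇔ Admissible β rows s
T-admissible zero    {s} β rows d s≤0 shape = mk⇔ (λ _ {_} {r′} {_} _ c<s → ⊥-elim (<⇒≱ c<s (s≤c r′))) (λ _ → _)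
  where
  s≤c : ∀ r′ {c} → lookupD 0 s r′ ≤ c
  s≤c r′ = ≤-trans (≤-reflexive (lookupD-zeros (largest-zeros s s≤0) r′)) z≤n
T-admissible (suc k) {s} β rows d s≡1+k shape =
  mk⇔ (columns⇒Admissible β rows d shape) (Admissible⇒columns β rows d)
  ⇔-∘ ((T-columnOk β (firstColumn (height s) rows) ×-⇔ T-admissible k _ _ (Decreasing-pred d) s⁻≡k (restColumns-shape d shape))
  ⇔-∘ T-∧)
  where
  s⁻≡k : largest (map pred s) ≡ k
  s⁻≡k = trans (largest-pred s) (cong pred s≡1+k)

-- Coinversions and attacks

guarded≡0⇔ : ∀ g b → ((if g then (if b then 0 else 1) else 0) ≡ 0) ⇔ (T g → T b)
guarded≡0⇔ true  true  = mk⇔ (λ _ _ → _) (λ _ → refl)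
guarded≡0⇔ true  false = mk⇔ (λ ()) (λ g⇒b → ⊥-elim (g⇒b _))
guarded≡0⇔ false b     = mk⇔ (λ _ ()) (λ _ → refl)

positive⇒<length : ∀ s {r} → 0 < lookupD 0 s r → r < length s
positive⇒<length (_ ∷ s) {zero}  _   = z<s
positive⇒<length (_ ∷ s) {suc r} pos = s<s (positive⇒<length s pos)

module _ (n : ℕ) {s : List ℕ} (bas : List ℕ) (rows : List (List ℕ)) (d : Decreasing s) (|s| : length s ≡ n) where

  open Filling n s bas rows

  F≡entry : ∀ r c → F r c ≡ entry bas rows r c
  F≡entry r zero    = refl
  F≡entry r (suc c) = refl

  private
    coinv≡0⇔ : coinv ≡ 0 ⇔ (∀ {r c r′} → r < n → c < shp r → r′ < n → coinvAt r (suc c) r′ ≡ 0)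
    coinv≡0⇔ = mk⇔ to from
      where
      expand : coinv ≡ ∑ (upTo n) (λ r → ∑ (upTo (shp r)) (λ c → ∑ (upTo n) (coinvAt r (suc c))))
      expand = trans (∑-concatMap _ (upTo n) _) (∑-cong (upTo n) (λ r → ∑-map _ (upTo (shp r)) _))
      to : coinv ≡ 0 → ∀ {r c r′} → r < n → c < shp r → r′ < n → coinvAt r (suc c) r′ ≡ 0
      to z {r} r<n c<s = Equivalence.to (∑-upTo≡0⇔ n _)
        (Equivalence.to (∑-upTo≡0⇔ (shp r) _) (Equivalence.to (∑-upTo≡0⇔ n _) (trans (sym expand) z) r<n) c<s)
      from : (∀ {r c r′} → r < n → c < shp r → r′ < n → coinvAt r (suc c) r′ ≡ 0) → coinv ≡ 0
      from z = trans expand (Equivalence.from (∑-upTo≡0⇔ n _) λ {r} r<n →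
        Equivalence.from (∑-upTo≡0⇔ (shp r) _) λ {c} c<s → Equivalence.from (∑-upTo≡0⇔ n _) λ {r′} → z {r} {c} {r′} r<n c<s)

    <n : ∀ {r c} → c < shp r → r < n
    <n c<s = subst (_ <_) |s| (positive⇒<length s (≤-<-trans z≤n c<s))

    typeA-guard : ℕ → ℕ → ℕ → Bool
    typeA-guard r c r′ = (r <ᵇ r′) ∧ (shp r′ ≤ᵇ shp r) ∧ (suc c ≤ᵇ shp r′)

    typeA-inversion : ℕ → ℕ → ℕ → Bool
    typeA-inversion r c r′ = isInversion (F r c) (F r (suc c)) (F r′ (suc c))

    typeA≡0⇔ : ∀ r c r′ → ((if typeA-guard r c r′ then (if typeA-inversion r c r′ then 0 else 1) else 0) ≡ 0)
                         ⇔ (T (typeA-guard r c r′) → T (typeA-inversion r c r′))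
    typeA≡0⇔ r c r′ = guarded≡0⇔ (typeA-guard r c r′) (typeA-inversion r c r′)

    typeB-vanishes : ∀ r c r′ → T ((r′ <ᵇ r) ∧ (shp r′ <ᵇ shp r) ∧ (c ≤ᵇ shp r′)) → ⊥
    typeB-vanishes r c r′ g with Equivalence.to T-∧ g
    ... | r′<r , g′ = <⇒≱ (<ᵇ⇒< _ _ (proj₁ (Equivalence.to (T-∧ {shp r′ <ᵇ shp r}) g′)))
                          (Decreasing-lookupD d (<⇒≤ (<ᵇ⇒< r′ r r′<r)))

  coinv≡0⇒Admissible : coinv ≡ 0 → Admissible bas rows s
  coinv≡0⇒Admissible z {r} {r′} {c} r<r′ c<s′ =
    subst (λ a → entry bas rows r′ (suc c) ≺[ a ] entry bas rows r (suc c)) (F≡entry r c)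
      (Equivalence.to inversion⇔≺ (Equivalence.to (typeA≡0⇔ r c r′) typeA≡0 guard))
    where
    s′≤s : shp r′ ≤ shp r
    s′≤s = Decreasing-lookupD d (<⇒≤ r<r′)
    typeA≡0 : (if typeA-guard r c r′ then (if typeA-inversion r c r′ then 0 else 1) else 0) ≡ 0
    typeA≡0 = m+n≡0⇒m≡0 _ (Equivalence.to coinv≡0⇔ z (<n (<-≤-trans c<s′ s′≤s)) (<-≤-trans c<s′ s′≤s) (<n c<s′))
    guard : T (typeA-guard r c r′)
    guard = Equivalence.from T-∧ (<⇒<ᵇ r<r′ , Equivalence.from T-∧ (≤⇒≤ᵇ s′≤s , <⇒<ᵇ c<s′))

  Admissible⇒coinv≡0 : Admissible bas rows s → coinv ≡ 0
  Admissible⇒coinv≡0 adm = Equivalence.from coinv≡0⇔ λ {r} {c} {r′} _ _ _ →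
    cong₂ _+_ (Equivalence.from (typeA≡0⇔ r c r′) (inverted r c r′))
              (Equivalence.from (guarded≡0⇔ _ _) (λ g → ⊥-elim (typeB-vanishes r c r′ g)))
    where
    inverted : ∀ r c r′ → T (typeA-guard r c r′) → T (typeA-inversion r c r′)
    inverted r c r′ g with Equivalence.to T-∧ g
    ... | r<r′ , g′ = Equivalence.from inversion⇔≺
      (subst (λ a → entry bas rows r′ (suc c) ≺[ a ] entry bas rows r (suc c)) (sym (F≡entry r c))
        (adm (<ᵇ⇒< r r′ r<r′) (<ᵇ⇒< c _ (proj₂ (Equivalence.to (T-∧ {shp r′ ≤ᵇ shp r}) g′)))))

  private
    T-and : ∀ {bs} → All T bs → T (foldr _∧_ true bs)
    T-and []       = _
    T-and (t ∷ ts) = Equivalence.from T-∧ (t , T-and ts)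

    All-cells : ∀ {P : ℕ × ℕ → Set} → (∀ {r c} → r < n → c ≤ shp r → P (r , c)) → All P cells
    All-cells f = All.concat⁺ (All.map⁺ (All.applyUpTo⁺₁ (λ r → r) n λ r<n →
                    All.map⁺ (All.applyUpTo⁺₁ (λ c → c) _ λ c<1+s → f r<n (s≤s⁻¹ c<1+s))))

    attacks-spec : ∀ r c r′ c′ → T (attacks (r , c) (r′ , c′)) →
      F r c ≡ F r′ c′ × (c ≡ c′ ⊎ (c′ ≡ suc c × r < r′) ⊎ (c ≡ suc c′ × r′ < r))
    attacks-spec r c r′ c′ t with Equivalence.to T-∧ t
    ... | e , t′ with Equivalence.to (T-∨ {c ≡ᵇ c′}) t′
    ...   | inj₁ c≡c′ = ≡ᵇ⇒≡ _ _ e , inj₁ (≡ᵇ⇒≡ c c′ c≡c′)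
    ...   | inj₂ t″ with Equivalence.to (T-∨ {(c′ ≡ᵇ suc c) ∧ (r <ᵇ r′)}) t″
    ...     | inj₁ t₁ with Equivalence.to T-∧ t₁
    ...       | c′≡1+c , r<r′ = ≡ᵇ⇒≡ _ _ e , inj₂ (inj₁ (≡ᵇ⇒≡ c′ (suc c) c′≡1+c , <ᵇ⇒< r r′ r<r′))
    attacks-spec r c r′ c′ t | e , t′ | inj₂ t″ | inj₂ t₂ with Equivalence.to T-∧ t₂
    ...       | c≡1+c′ , r′<r = ≡ᵇ⇒≡ _ _ e , inj₂ (inj₂ (≡ᵇ⇒≡ c (suc c′) c≡1+c′ , <ᵇ⇒< r′ r r′<r))

  module _ (bas-injective : ∀ {r r′} → r < n → r′ < n → lookupD 0 bas r ≡ lookupD 0 bas r′ → r ≡ r′)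
           (adm : Admissible bas rows s) where

    private
      column-distinct : ∀ {r r′ c} → r < r′ → r′ < n → c ≤ shp r′ → F r c ≢ F r′ c
      column-distinct {c = zero}  r<r′ r′<n _   e = <-irrefl (bas-injective (<-trans r<r′ r′<n) r′<n e) r<r′
      column-distinct {c = suc c} r<r′ _    c<s e = ≺⇒≢ (adm r<r′ c<s) (sym e)

      diagonal-distinct : ∀ {r r′ c} → r < r′ → suc c ≤ shp r′ → F r c ≢ F r′ (suc c)
      diagonal-distinct {r} {c = c} r<r′ c<s e = ≺⇒≢cut (adm r<r′ c<s) (sym (trans (sym (F≡entry r c)) e))

      no-attack : ∀ {r c r′ c′} → r < n → c ≤ shp r → r′ < n → c′ ≤ shp r′ →
        T (sameCell (r , c) (r′ , c′) ∨ not (attacks (r , c) (r′ , c′)))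
      no-attack {r} {c} {r′} {c′} r<n c≤s r′<n c′≤s with attacks (r , c) (r′ , c′) in eq
      ... | false = Equivalence.from (T-∨ {sameCell (r , c) (r′ , c′)}) (inj₂ _)
      ... | true with attacks-spec r c r′ c′ (subst T (sym eq) _)
      ...   | e , inj₁ refl with <-cmp r r′
      ...     | tri< r<r′ _ _ = ⊥-elim (column-distinct r<r′ r′<n c′≤s e)
      ...     | tri≈ _ refl _ = Equivalence.from T-∨ (inj₁ (Equivalence.from T-∧ (≡⇒≡ᵇ r r refl , ≡⇒≡ᵇ c c refl)))
      ...     | tri> _ _ r′<r = ⊥-elim (column-distinct r′<r r<n c≤s (sym e))
      no-attack _ _ _ c′≤s | true | e , inj₂ (inj₁ (refl , r<r′)) = ⊥-elim (diagonal-distinct r<r′ c′≤s e)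
      no-attack _ c≤s _ _  | true | e , inj₂ (inj₂ (refl , r′<r)) = ⊥-elim (diagonal-distinct r′<r c≤s (sym e))

    Admissible⇒nonAttacking : T nonAttacking
    Admissible⇒nonAttacking =
      T-and (All.concat⁺ (All.map⁺ (All-cells λ r<n c≤s → All.map⁺ (All-cells λ r′<n c′≤s → no-attack r<n c≤s r′<n c′≤s))))

-- Letters are 1, …, n while list positions start at 0.
xAt : List ℕ → ℕ → ℕ
xAt xs v = lookupD 0 xs (v ∸ 1)

map-xAt-alphabet : ∀ n xs → length xs ≡ n → map (xAt xs) (alphabet n) ≡ xs
map-xAt-alphabet n xs refl = begin
  map (xAt xs) (map suc (upTo (length xs))) ≡⟨ map-∘ (upTo (length xs)) ⟨
  map (lookupD 0 xs) (upTo (length xs))     ≡⟨ map-lookupD-upTo 0 xs ⟩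
  xs                                        ∎
  where open ≡-Reasoning

monomial≡monomialOf : ∀ n s bas rows xs → rows HasShape s → length rows ≡ n →
  Filling.monomial n s bas rows xs ≡ monomialOf (xAt xs) rows
monomial≡monomialOf n s bas rows xs shape refl = begin
  Filling.monomial n s bas rows xs
    ≡⟨ trans (∏-concatMap _ (upTo n) _) (∏-cong (upTo n) (λ r → ∏-map _ (upTo (lookupD 0 s r)) _)) ⟩
  ∏ (upTo n) (λ r → ∏ (upTo (lookupD 0 s r)) (λ c → xAt xs (lookupD 0 (row r) c)))
    ≡⟨ ∏-cong (upTo n) (λ r → trans (cong (λ m → ∏ (upTo m) (λ c → xAt xs (lookupD 0 (row r) c)))
                                            (sym (HasShape-lookupD shape r)))
                                      (∏-lookupD 0 (row r) (xAt xs))) ⟩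
  ∏ (upTo (length rows)) (λ r → ∏ (row r) (xAt xs))
    ≡⟨ ∏-lookupD [] rows (λ w → ∏ w (xAt xs)) ⟩
  monomialOf (xAt xs) rows ∎
  where
  open ≡-Reasoning
  row : ℕ → List ℕ
  row r = lookupD [] rows r

basement : ∀ {n} → Permutation′ n → List ℕ
basement {n} σ = map (λ i → suc (toℕ (σ ⟨$⟩ʳ i))) (allFin n)

basement-injective : ∀ n (σ : Permutation′ n) {r r′} → r < n → r′ < n →
  lookupD 0 (basement σ) r ≡ lookupD 0 (basement σ) r′ → r ≡ r′
basement-injective n σ {r} {r′} r<n r′<n e = begin
  r                 ≡⟨ toℕ-fromℕ< r<n ⟨
  toℕ (fromℕ< r<n)  ≡⟨ cong toℕ (σ-injective (toℕ-injective (suc-injective at-r≡at-r′))) ⟩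
  toℕ (fromℕ< r′<n) ≡⟨ toℕ-fromℕ< r′<n ⟩
  r′                ∎
  where
  open ≡-Reasoning
  f : Fin n → ℕ
  f i = suc (toℕ (σ ⟨$⟩ʳ i))
  at : ∀ {r} (r<n : r < n) → lookupD 0 (map f (allFin n)) r ≡ f (fromℕ< r<n)
  at r<n = trans (cong (λ L → lookupD 0 L _) (map-tabulate (λ i → i) f)) (lookupD-tabulate 0 f r<n)
  at-r≡at-r′ : f (fromℕ< r<n) ≡ f (fromℕ< r′<n)
  at-r≡at-r′ = trans (sym (at r<n)) (trans e (at r′<n))
  σ-injective : ∀ {i j} → σ ⟨$⟩ʳ i ≡ σ ⟨$⟩ʳ j → i ≡ j
  σ-injective {i} {j} σi≡σj = trans (sym (inverseˡ σ)) (trans (cong (σ ⟨$⟩ˡ_) σi≡σj) (inverseˡ σ))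

module _ (n : ℕ) {s : List ℕ} (bas xs : List ℕ) (d : Decreasing s) (|s| : length s ≡ n)
         (bas-injective : ∀ {r r′} → r < n → r′ < n → lookupD 0 bas r ≡ lookupD 0 bas r′ → r ≡ r′) where

  summand-at-q1-t0 : ∀ rows → rows HasShape s → let open Filling n s bas rows in
    𝟙 (does (nonAttacking Bool.≟ true)) * (monomial xs * 1 ^ maj * 0 ^ coinv)
    ≡ 𝟙 (admissible (largest s) s bas rows) * monomialOf (xAt xs) rows
  summand-at-q1-t0 rows shape with admissible (largest s) s bas rows in eq
  ... | true  = admissible-summand (Equivalence.to (T-admissible (largest s) bas rows d refl shape) (subst T (sym eq) _))
    where
    admissible-summand : Admissible bas rows s → let open Filling n s bas rows in
      𝟙 (does (nonAttacking Bool.≟ true)) * (monomial xs * 1 ^ maj * 0 ^ coinv) ≡ 1 * monomialOf (xAt xs) rows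
    admissible-summand adm
      rewrite Admissible⇒coinv≡0 n bas rows d |s| adm
            | Equivalence.to T-≡ (Admissible⇒nonAttacking n bas rows d |s| bas-injective adm)
            | ^-zeroˡ (Filling.maj n s bas rows)
            | monomial≡monomialOf n s bas rows xs shape (trans (Pointwise-length shape) |s|) =
      cong (_+ 0) (trans (*-identityʳ _) (*-identityʳ _))
  ... | false with Filling.coinv n s bas rows in ec
  ...   | zero  = ⊥-elim (subst T eq (Equivalence.from (T-admissible (largest s) bas rows d refl shape)
                                        (coinv≡0⇒Admissible n bas rows d |s| ec)))
  ...   | suc _ = let open Filling n s bas rows ; a = 𝟙 (does (nonAttacking Bool.≟ true)) in
    trans (cong (a *_) (*-zeroʳ (monomial xs * 1 ^ maj))) (*-zeroʳ a)

corollary3p2 : (n : ℕ) → 1 ≤ n → (σ : Permutation′ n) → (λ' : List ℕ) →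
    IsPartition λ' → length λ' ≤ n → (x : Vec ℕ n) →
    E-at-t0 n σ (pad n λ') 1 x ≡ elemProd (conjugate λ') (toList x)
corollary3p2 n _ σ λ′ (λ′-decreasing , _) |λ′|≤n x = begin
  E-at-t0 n σ s 1 x
    ≡⟨ ∑-filter (λ rows → Filling.nonAttacking n s bas rows Bool.≟ true) (fillings n s) _ ⟩
  ∑ (fillings n s) (λ rows → let open Filling n s bas rows in
                             𝟙 (does (nonAttacking Bool.≟ true)) * (monomial xs * 1 ^ maj * 0 ^ coinv))
    ≡⟨ ∑-cong-local (All.map (summand-at-q1-t0 n bas xs s-decreasing |s| (basement-injective n σ) _) (fillings-shape n s)) ⟩
  ∑ (fillings n s) (λ rows → 𝟙 (admissible (largest s) s bas rows) * monomialOf (xAt xs) rows)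
    ≡⟨ ∑-admissible n (xAt xs) (largest s) s-decreasing refl bas ⟩
  ∏ (conjugate s) (λ h → esym h (map (xAt xs) (alphabet n)))
    ≡⟨ cong₂ (λ ν ys → ∏ ν (λ h → esym h ys)) (conjugate-pad n λ′) (map-xAt-alphabet n xs (length-toList x)) ⟩
  ∏ (conjugate λ′) (λ h → esym h xs)
    ≡⟨ ∏-cong (conjugate λ′) (λ h → sym (elem≡esym h xs)) ⟩
  elemProd (conjugate λ′) xs ∎
  where
  open ≡-Reasoning
  s bas xs : List ℕ
  s   = pad n λ′
  bas = basement σ
  xs  = toList x
  s-decreasing : Decreasing s
  s-decreasing = Decreasing-++-zeros λ′-decreasing (n ∸ length λ′)
  |s| : length s ≡ n
  |s| = length-pad n λ′ |λ′|≤n
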